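{- Let $r\geq 2$ and $n\geq 2$ be integers and fix an $r$-coloring of the edges of $K_n$. Let $\mathcal{C}$ be the set of all monochromatic components, let $\mathcal{X}\subseteq\mathcal{C}$ and $x=|\mathcal{X}|$. Suppose $\gamma\in[0,r]$ and $z\in\mathbb{R}^+$ are constants such that $\sum_{C\in\mathcal{X}}|V(C)|\geq \gamma n$ and $\max_{C\in\mathcal{C}}|E(C)|\leq z\binom{n}{2}$. Then \[ z(r-\gamma)^2\geq \max(1-xz,0)^2. \]
   Context: For an $r$-coloring of the edges of $K_n$ with colors $1,\dots,r$, let $G_i$ be the spanning subgraph on all $n$ vertices consisting of the edges of color $i$, and let $\mathcal{C}_i$ be the set of connected components of $G_i$ (isolated vertices included as components). $\mathcal{C}=\bigcup_{i=1}^r\mathcal{C}_i$ is the set of all monochromatic components, components of different colors being regarded as distinct elements. $V(C)$, $E(C)$ denote the vertex and edge sets of a component $C$.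
   Formalization: The constants γ and z range over the rationals rather than the reals. -}

module Defs where

open import Data.Nat using (ℕ; zero; suc; _<ᵇ_)
open import Data.Nat.Combinatorics using (_C_)
open import Data.Fin using (Fin; toℕ)
open import Data.Fin.Subset using (Subset; _∈_; ∣_∣)
open import Data.Fin.Subset.Properties using (_∈?_)
open import Data.List using (List; map; allFin)
open import Data.Nat.ListAction using (sum)
open import Data.Product using (Σ; ∃; _×_; proj₁; proj₂)
open import Data.Bool using (Bool; true; false; if_then_else_; _∧_)
open import Data.Integer using (+_)
open import Data.Rational using (ℚ; _/_; _*_)
open import Relation.Binary.PropositionalEquality using (_≡_; _≢_)
open import Relation.Nullary.Decidable using (⌊_⌋)
open import Data.Fin using (_≟_)

-- We use a function on
-- ordered pairs required to be symmetric; its diagonal values are irrelevant.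
record Coloring (n r : ℕ) : Set where
  field
    col : Fin n → Fin n → Fin r
    sym : ∀ u v → col u v ≡ col v u
open Coloring public

Edge : ∀ {n r} → Coloring n r → Fin r → Fin n → Fin n → Set
Edge c i u v = u ≢ v × col c u v ≡ i

data Walk {n r} (c : Coloring n r) (i : Fin r) : Fin n → Fin n → Set where
  here : ∀ {u} → Walk c i u u
  step : ∀ {u w v} → Edge c i u w → Walk c i w v → Walk c i u v

record IsComponent {n r} (c : Coloring n r) (i : Fin r) (S : Subset n) : Set where
  field
    nonempty  : ∃ λ u → u ∈ S
    connected : ∀ u v → u ∈ S → v ∈ S → Walk c i u v
    closed    : ∀ u v → u ∈ S → Edge c i u v → v ∈ S

-- A monochromatic component: a colour together with a component of that colour
-- (components of different colours are distinct elements).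
MonoComp : ∀ {n r} → Coloring n r → Set
MonoComp {n} {r} c = Σ (Fin r) λ i → Σ (Subset n) λ S → IsComponent c i S

compColour : ∀ {n r} {c : Coloring n r} → MonoComp c → Fin r
compColour C = proj₁ C

compVerts : ∀ {n r} {c : Coloring n r} → MonoComp c → Subset n
compVerts C = proj₁ (proj₂ C)

vsize : ∀ {n r} {c : Coloring n r} → MonoComp c → ℕ
vsize C = ∣ compVerts C ∣

edgeCount : ∀ {n r} → Coloring n r → Fin r → Subset n → ℕ
edgeCount {n} c i S =
  sum (map (λ u → sum (map (λ v →
    if (toℕ u <ᵇ toℕ v) ∧ ⌊ u ∈? S ⌋ ∧ ⌊ v ∈? S ⌋ ∧ ⌊ col c u v ≟ i ⌋
    then 1 else 0) (allFin n))) (allFin n))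

esize : ∀ {n r} {c : Coloring n r} → MonoComp c → ℕ
esize {c = c} C = edgeCount c (compColour C) (compVerts C)

ℕ→ℚ : ℕ → ℚ
ℕ→ℚ k = + k / 1

-- Two monochromatic components are the same element of 𝒞 iff they have the
-- same colour and the same vertex set (proof components are irrelevant).
open import Relation.Nullary using (¬_)
SameComp : ∀ {n r} {c : Coloring n r} → MonoComp c → MonoComp c → Set
SameComp A B = compColour A ≡ compColour B × compVerts A ≡ compVerts B

DistinctComp : ∀ {n r} {c : Coloring n r} → MonoComp c → MonoComp c → Set
DistinctComp A B = ¬ SameComp A B

-- For each colour i, the vertices lying in no colour-i component of X form a union of
-- colour-i components; let L collect these components over all colours.  Every pair
-- (colour, vertex) lies in exactly one monochromatic component, so |V(L)| + |V(X)| ≤ rn,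
-- and every edge lies in a component of its own colour, so N := (n choose 2) ≤ |E(L)| + |E(X)|.
-- With |E(X)| ≤ xzN and |V(X)| ≥ γn this gives |E(L)| ≥ (1 - xz)N and |V(L)| ≤ (r - γ)n.
-- A component K has |E(K)| ≤ (|V(K)| choose 2) ≤ |V(K)|² N / n², which together with
-- |E(K)| ≤ zN gives |E(K)| n ≤ √z N |V(K)|.  Summing over L,
-- max(1 - xz, 0) N n ≤ |E(L)| n ≤ √z N |V(L)| ≤ √z N (r - γ) n.
-- Every inequality involving √z is handled in squared form.

module Submission where

open import Defs renaming (sym to col-sym)

module Combinatorics where

  open import Data.Nat as ℕ using (ℕ; zero; suc; _+_; _*_; _≤_; _<_; z≤n; s≤s; _<ᵇ_)
  open import Data.Nat.Properties as ℕ
    using (≤-refl; ≤-trans; ≤-reflexive; +-mono-≤; m≤m+n; m≤n+m; +-comm; module ≤-Reasoning)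
  open import Data.Nat.Combinatorics using (_C_; nC1≡n; nCk+nC[k+1]≡[n+1]C[k+1])
  open import Data.Nat.ListAction using (sum)
  open import Data.Nat.Tactic.RingSolver using (solve-∀)
  open import Algebra.Properties.CommutativeMonoid.Sum ℕ.+-0-commutativeMonoid
    using (sum-syntax; sum-cong-≗; ∑-distrib-+; ∑-comm)
    renaming (sum to ∑)
  open import Data.Bool using (Bool; true; false; _∧_; not; T; if_then_else_)
  open import Data.Unit using (⊤; tt)
  open import Data.Empty using (⊥-elim)
  open import Data.Bool.Properties using (∧-zeroʳ; ∧-identityʳ; T-∧)
  open import Function.Bundles using (Equivalence)
  open import Data.Fin using (Fin; zero; suc; toℕ; _≟_)
  open import Data.Fin.Properties using (suc-injective; any?)
  open import Data.Fin.Subset using (Subset; _∈_; _∉_; ∣_∣; _∪_; ⁅_⁆; inside; outside)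
  open import Data.Fin.Subset.Properties
    using (_∈?_; ⊆-antisym; ∪-identityʳ; ∣p∣≤n; drop-there; p⊆p∪q; x∈p∪q⁻;
           x∈⁅x⁆; x∈⁅y⁆⇒x≡y)
  open import Data.Vec using ([]; _∷_; here; there)
  open import Data.List using (List; []; _∷_; _++_; map; tabulate)
  open import Data.Bool.ListAction using (any)
  open import Data.List.Properties using (map-++; map-cong; map-∘)
  open import Data.Nat.ListAction.Properties using (sum-++)
  open import Data.List.Relation.Unary.All as All using (All; []; _∷_)
  open import Data.List.Relation.Unary.Any as Any using (Any; here; there)
  open import Data.List.Relation.Unary.AllPairs as AllPairs using (AllPairs; []; _∷_)
  import Data.List.Relation.Unary.AllPairs.Properties as AllPairs
  import Data.List.Relation.Unary.All.Properties as All
  import Data.List.Relation.Unary.Any.Properties as Any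
  open import Data.List.Relation.Unary.Any.Properties using (any⁺; any⁻)
  open import Data.Product using (Σ; ∃₂; _×_; _,_; proj₁; proj₂)
  open import Data.Sum using ([_,_]′)
  open import Function using (_∘_; id)
  open import Relation.Binary.PropositionalEquality
  open import Relation.Nullary using (¬_; Dec; yes; no)
  open import Relation.Nullary.Decidable using (⌊_⌋; T?; ¬?; _×-dec_; toWitness; fromWitness; ⌊⌋-map′)

  ∑-mono-≤ : ∀ {n} {f g : Fin n → ℕ} → (∀ i → f i ≤ g i) → ∑ f ≤ ∑ g
  ∑-mono-≤ {zero}  f≤g = z≤n
  ∑-mono-≤ {suc n} f≤g = +-mono-≤ (f≤g zero) (∑-mono-≤ (f≤g ∘ suc))

  ∑-zero : ∀ {n} {f : Fin n → ℕ} → (∀ i → f i ≡ 0) → ∑ f ≡ 0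
  ∑-zero {zero}  f≡0 = refl
  ∑-zero {suc n} f≡0 = cong₂ _+_ (f≡0 zero) (∑-zero (f≡0 ∘ suc))

  ∑-single : ∀ {n} (j : Fin n) {f : Fin n → ℕ} → (∀ i → j ≢ i → f i ≡ 0) → ∑ f ≡ f j
  ∑-single {suc n} zero    {f} f≡0 = trans (cong (f zero +_) (∑-zero (λ i → f≡0 (suc i) λ ()))) (ℕ.+-identityʳ _)
  ∑-single {suc n} (suc j) {f} f≡0 =
    trans (cong (_+ ∑ (f ∘ suc)) (f≡0 zero λ ())) (∑-single j (λ i j≢i → f≡0 (suc i) (j≢i ∘ suc-injective)))

  ∑-const : ∀ m k → ∑ {m} (λ _ → k) ≡ m * k
  ∑-const zero    k = refl
  ∑-const (suc m) k = cong (k +_) (∑-const m k)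

  sum-map-zero : ∀ {A : Set} {f : A → ℕ} (xs : List A) → All (λ x → f x ≡ 0) xs → sum (map f xs) ≡ 0
  sum-map-zero []       []           = refl
  sum-map-zero (x ∷ xs) (fx≡0 ∷ fxs) = cong₂ _+_ fx≡0 (sum-map-zero xs fxs)

  sum-map-++ : ∀ {A : Set} (f : A → ℕ) (xs ys : List A) → sum (map f (xs ++ ys)) ≡ sum (map f xs) + sum (map f ys)
  sum-map-++ f xs ys = trans (cong sum (map-++ f xs ys)) (sum-++ (map f xs) (map f ys))

  sum-map-∑ : ∀ {A : Set} {m} (g : A → Fin m → ℕ) (xs : List A) →
              sum (map (λ x → ∑ (g x)) xs) ≡ ∑ (λ i → sum (map (λ x → g x i) xs))
  sum-map-∑ {m = m} g []       = sym (∑-zero {m} λ _ → refl)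
  sum-map-∑         g (x ∷ xs) = trans (cong (∑ (g x) +_) (sum-map-∑ g xs)) (sym (∑-distrib-+ (g x) _))

  sum-map-cong : ∀ {A : Set} {f g : A → ℕ} (xs : List A) → (∀ x → f x ≡ g x) → sum (map f xs) ≡ sum (map g xs)
  sum-map-cong xs f≗g = cong sum (map-cong f≗g xs)

  0<sum-map : ∀ {A : Set} {f : A → ℕ} {xs : List A} → Any (λ x → 1 ≤ f x) xs → 1 ≤ sum (map f xs)
  0<sum-map (here  1≤fx)  = ≤-trans 1≤fx (m≤m+n _ _)
  0<sum-map (there 1≤fxs) = ≤-trans (0<sum-map 1≤fxs) (m≤n+m _ _)

  sum-map-*ʳ : ∀ {A : Set} (f : A → ℕ) k (xs : List A) → sum (map (λ x → f x * k) xs) ≡ sum (map f xs) * k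
  sum-map-*ʳ f k []       = refl
  sum-map-*ʳ f k (x ∷ xs) = trans (cong (f x * k +_) (sum-map-*ʳ f k xs)) (sym (ℕ.*-distribʳ-+ k (f x) _))

  sum-map-tabulate : ∀ {A : Set} {n} (g : Fin n → A) (f : A → ℕ) → sum (map f (tabulate g)) ≡ ∑ (f ∘ g)
  sum-map-tabulate {n = zero}  g f = refl
  sum-map-tabulate {n = suc n} g f = cong (f (g zero) +_) (sum-map-tabulate (g ∘ suc) f)

  ⌊≟⌋-self : ∀ {n} (j : Fin n) → ⌊ j ≟ j ⌋ ≡ true
  ⌊≟⌋-self j with j ≟ j
  ... | yes _   = refl
  ... | no  j≢j = ⊥-elim (j≢j refl)

  ⌊≟⌋-other : ∀ {n} {j i : Fin n} → j ≢ i → ⌊ j ≟ i ⌋ ≡ false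
  ⌊≟⌋-other {j = j} {i} j≢i with j ≟ i
  ... | yes j≡i = ⊥-elim (j≢i j≡i)
  ... | no  _   = refl

  𝟙 : Bool → ℕ
  𝟙 b = if b then 1 else 0

  𝟙≤1 : ∀ b → 𝟙 b ≤ 1
  𝟙≤1 true  = ≤-refl
  𝟙≤1 false = z≤n

  𝟙-mono-≤ : ∀ {a b} → (T a → T b) → 𝟙 a ≤ 𝟙 b
  𝟙-mono-≤ {false}         a⇒b = z≤n
  𝟙-mono-≤ {true}  {true}  a⇒b = ≤-refl
  𝟙-mono-≤ {true}  {false} a⇒b = ⊥-elim (a⇒b tt)

  𝟙-false : ∀ {b} → ¬ T b → 𝟙 b ≡ 0
  𝟙-false {false} _  = refl
  𝟙-false {true}  ¬b = ⊥-elim (¬b tt)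

  T-not⁺ : ∀ {b} → ¬ T b → T (not b)
  T-not⁺ {false} _  = tt
  T-not⁺ {true}  ¬b = ¬b tt

  T-not⁻ : ∀ {b} → T (not b) → ¬ T b
  T-not⁻ {false} _ ()

  -- Pointwise step of edgesIn-split: an edge (e) with ends in p, q has either both ends
  -- in the closed set (k, l) or neither.
  𝟙-split : ∀ p q k l e → (T k → T p) → (T l → T q) → (T e → T k → T l) → (T e → T l → T k) →
            𝟙 (p ∧ q ∧ e) ≡ 𝟙 ((p ∧ not k) ∧ (q ∧ not l) ∧ e) + 𝟙 (k ∧ l ∧ e)
  𝟙-split false q     true  l     e     k⇒p _   _   _   = ⊥-elim (k⇒p tt)
  𝟙-split p     false k     true  e     _   l⇒q _   _   = ⊥-elim (l⇒q tt)
  𝟙-split p     q     false false e     _   _   _   _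
    rewrite ∧-identityʳ p | ∧-identityʳ q = sym (ℕ.+-identityʳ _)
  𝟙-split true  true  true  true  e     _   _   _   _   = refl
  𝟙-split true  q     true  false false _   _   _   _   rewrite ∧-zeroʳ q = refl
  𝟙-split true  q     true  false true  _   _   k⇒l _   = ⊥-elim (k⇒l tt tt)
  𝟙-split p     true  false true  false _   _   _   _   rewrite ∧-zeroʳ p | ∧-identityʳ p | ∧-zeroʳ p = refl
  𝟙-split p     true  false true  true  _   _   _   l⇒k = ⊥-elim (l⇒k tt tt)

  count : ∀ {n} → (Fin n → Bool) → ℕ
  count P = ∑ (𝟙 ∘ P)

  count≤n : ∀ {n} (P : Fin n → Bool) → count P ≤ n
  count≤n {zero}  P = z≤n
  count≤n {suc n} P = +-mono-≤ (𝟙≤1 (P zero)) (count≤n (P ∘ suc))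

  count-true : ∀ n → count {n} (λ _ → true) ≡ n
  count-true zero    = refl
  count-true (suc n) = cong suc (count-true n)

  count-none : ∀ {n} {P : Fin n → Bool} → (∀ u → ¬ T (P u)) → count P ≡ 0
  count-none ¬P = ∑-zero (𝟙-false ∘ ¬P)

  0<count : ∀ {n} (P : Fin n → Bool) {u} → T (P u) → 1 ≤ count P
  0<count {suc n} P {zero}  Pu = ≤-trans (𝟙-mono-≤ (λ _ → Pu)) (m≤m+n _ _)
  0<count {suc n} P {suc u} Pu = ≤-trans (0<count (P ∘ suc) Pu) (m≤n+m _ _)

  count-cong : ∀ {n} {P Q : Fin n → Bool} → (∀ u → P u ≡ Q u) → count P ≡ count Q
  count-cong P≗Q = sum-cong-≗ (cong 𝟙 ∘ P≗Q)

  _∖_ : ∀ {n} → (Fin n → Bool) → (Fin n → Bool) → Fin n → Bool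
  (P ∖ K) u = P u ∧ not (K u)

  count-split : ∀ {n} (P K : Fin n → Bool) → (∀ u → T (K u) → T (P u)) → count P ≡ count (P ∖ K) + count K
  count-split P K K⊆P =
    trans (sum-cong-≗ (λ u → split (P u) (K u) (K⊆P u))) (∑-distrib-+ (𝟙 ∘ (P ∖ K)) (𝟙 ∘ K))
    where
    split : ∀ p k → (T k → T p) → 𝟙 p ≡ 𝟙 (p ∧ not k) + 𝟙 k
    split false true  k⇒p = ⊥-elim (k⇒p tt)
    split false false _   = refl
    split true  false _   = refl
    split true  true  _   = refl

  Disjoint : ∀ {n} → (Fin n → Bool) → (Fin n → Bool) → Set
  Disjoint P Q = ∀ u → T (P u) → ¬ T (Q u)

  count-disjoint : ∀ {n} (Ps : List (Fin n → Bool)) → AllPairs Disjoint Ps → sum (map count Ps) ≤ n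
  count-disjoint {n} Ps Ps-disjoint = begin
    sum (map count Ps)                    ≡⟨ sum-map-∑ (λ P u → 𝟙 (P u)) Ps ⟩
    ∑ (λ u → sum (map (λ P → 𝟙 (P u)) Ps)) ≤⟨ ∑-mono-≤ (λ u → at-most-one u Ps Ps-disjoint) ⟩
    count {n} (λ _ → true)                ≡⟨ count-true n ⟩
    n                                     ∎
    where
    open ≤-Reasoning
    at-most-one : ∀ u Ps → AllPairs Disjoint Ps → sum (map (λ P → 𝟙 (P u)) Ps) ≤ 1
    at-most-one u []       []                    = z≤n
    at-most-one u (P ∷ Ps) (P-disj ∷ Ps-disjoint) with P u in Pu
    ... | false = at-most-one u Ps Ps-disjoint
    ... | true  = ≤-reflexive (cong suc (sum-map-zero Ps
                    (All.map (λ {Q} P∩Q≡∅ → 𝟙-false (P∩Q≡∅ u (subst T (sym Pu) tt))) P-disj)))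

  _≺_ : ∀ {n} → Fin n → Fin n → Bool
  u ≺ v = toℕ u <ᵇ toℕ v

  ≺⇒≢ : ∀ {n} {u v : Fin n} → T (u ≺ v) → u ≢ v
  ≺⇒≢ {u = u} {v} u≺v refl = ℕ.<⇒≢ (ℕ.<ᵇ⇒< (toℕ u) (toℕ v) u≺v) refl

  pairsWith : ∀ {n} → (Fin n → Fin n → Bool) → ℕ
  pairsWith R = ∑ λ u → ∑ λ v → 𝟙 (u ≺ v ∧ R u v)

  pairsWith-mono-≤ : ∀ {n} {R S : Fin n → Fin n → Bool} →
                     (∀ u v → T (R u v) → T (S u v)) → pairsWith R ≤ pairsWith S
  pairsWith-mono-≤ R⇒S = ∑-mono-≤ λ u → ∑-mono-≤ λ v → 𝟙-mono-≤ (∧-monoʳ (R⇒S u v))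
    where
    ∧-monoʳ : ∀ {a b c} → (T b → T c) → T (a ∧ b) → T (a ∧ c)
    ∧-monoʳ {true} b⇒c = b⇒c

  pairsWith-cong : ∀ {n} {R S : Fin n → Fin n → Bool} → (∀ u v → R u v ≡ S u v) → pairsWith R ≡ pairsWith S
  pairsWith-cong R≗S = sum-cong-≗ λ u → sum-cong-≗ λ v → cong (λ b → 𝟙 (u ≺ v ∧ b)) (R≗S u v)

  pairsWith-none : ∀ {n} {R : Fin n → Fin n → Bool} → (∀ u v → ¬ T (R u v)) → pairsWith R ≡ 0
  pairsWith-none {n} ¬R = ∑-zero λ u → ∑-zero {n} λ v → 𝟙-false (¬R u v ∘ proj₂ ∘ Equivalence.to T-∧)

  pairsWith-split : ∀ {n} {R S S′ : Fin n → Fin n → Bool} →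
                    (∀ u v → T (u ≺ v) → 𝟙 (R u v) ≡ 𝟙 (S u v) + 𝟙 (S′ u v)) →
                    pairsWith R ≡ pairsWith S + pairsWith S′
  pairsWith-split {R = R} {S} {S′} split =
    trans (sum-cong-≗ λ u → trans (sum-cong-≗ (split-at u)) (∑-distrib-+ (row S u) (row S′ u)))
          (∑-distrib-+ (∑ ∘ row S) (∑ ∘ row S′))
    where
    row : (Fin _ → Fin _ → Bool) → Fin _ → Fin _ → ℕ
    row Q u v = 𝟙 (u ≺ v ∧ Q u v)
    split-at : ∀ u v → 𝟙 (u ≺ v ∧ R u v) ≡ 𝟙 (u ≺ v ∧ S u v) + 𝟙 (u ≺ v ∧ S′ u v)
    split-at u v with u ≺ v in u≺v
    ... | false = refl
    ... | true  = split u v (subst T (sym u≺v) tt)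

  pairsIn : ∀ {n} → (Fin n → Bool) → ℕ
  pairsIn P = pairsWith (λ u v → P u ∧ P v)

  2*[mC2]+m≡m*m : ∀ m → 2 * (m C 2) + m ≡ m * m
  2*[mC2]+m≡m*m zero    = refl
  2*[mC2]+m≡m*m (suc m) = begin
    2 * (suc m C 2) + suc m          ≡⟨ cong (λ t → 2 * t + suc m) (sym (nCk+nC[k+1]≡[n+1]C[k+1] m 1)) ⟩
    2 * (m C 1 + m C 2) + suc m      ≡⟨ cong (λ t → 2 * (t + m C 2) + suc m) (nC1≡n m) ⟩
    2 * (m + m C 2) + suc m          ≡⟨ regroup m (m C 2) ⟩
    (2 * (m C 2) + m) + (1 + 2 * m)  ≡⟨ cong (_+ (1 + 2 * m)) (2*[mC2]+m≡m*m m) ⟩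
    m * m + (1 + 2 * m)              ≡⟨ square-suc m ⟩
    suc m * suc m                    ∎
    where
    open ≡-Reasoning
    regroup : ∀ m p → 2 * (m + p) + suc m ≡ (2 * p + m) + (1 + 2 * m)
    regroup = solve-∀
    square-suc : ∀ m → m * m + (1 + 2 * m) ≡ suc m * suc m
    square-suc = solve-∀

  [mC2]*[n*n]≤[m*m]*[nC2] : ∀ {m n} → m ≤ n → (m C 2) * (n * n) ≤ (m * m) * (n C 2)
  [mC2]*[n*n]≤[m*m]*[nC2] {m} {n} m≤n = ℕ.*-cancelˡ-≤ 2 (ℕ.+-cancelʳ-≤ (m * (n * n)) _ _ (begin
    2 * ((m C 2) * (n * n)) + m * (n * n)  ≡⟨ distrib (m C 2) m (n * n) ⟩
    (2 * (m C 2) + m) * (n * n)            ≡⟨ cong (_* (n * n)) (2*[mC2]+m≡m*m m) ⟩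
    (m * m) * (n * n)                      ≡⟨ cong ((m * m) *_) (2*[mC2]+m≡m*m n) ⟨
    (m * m) * (2 * (n C 2) + n)            ≡⟨ expand m (n C 2) n ⟩
    2 * ((m * m) * (n C 2)) + m * (m * n)  ≤⟨ ℕ.+-monoʳ-≤ _ (ℕ.*-monoʳ-≤ m (ℕ.*-monoˡ-≤ n m≤n)) ⟩
    2 * ((m * m) * (n C 2)) + m * (n * n)  ∎))
    where
    open ≤-Reasoning
    distrib : ∀ x m s → 2 * (x * s) + m * s ≡ (2 * x + m) * s
    distrib = solve-∀
    expand : ∀ m y n → (m * m) * (2 * y + n) ≡ 2 * ((m * m) * y) + m * (m * n)
    expand = solve-∀

  0<nC2 : ∀ {n} → 2 ≤ n → 0 < n C 2
  0<nC2 {suc zero}    (s≤s ())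
  0<nC2 {suc (suc k)} _ = subst (0 <_) (nCk+nC[k+1]≡[n+1]C[k+1] (suc k) 1)
    (subst (λ t → 0 < t + suc k C 2) (sym (nC1≡n (suc k))) (s≤s z≤n))

  2*pairsIn+count≡count² : ∀ {n} (P : Fin n → Bool) → 2 * pairsIn P + count P ≡ count P * count P
  2*pairsIn+count≡count² {zero}  P = refl
  2*pairsIn+count≡count² {suc n} P with P zero
  ... | false = trans (cong (λ t → 2 * (t + p) + s) (∑-zero {n} λ _ → refl)) (2*pairsIn+count≡count² (P ∘ suc))
    where
    s = count (P ∘ suc)
    p = pairsIn (P ∘ suc)
  ... | true  = begin
    2 * (s + p) + (1 + s)       ≡⟨ regroup s p ⟩
    (2 * p + s) + (1 + 2 * s)   ≡⟨ cong (_+ (1 + 2 * s)) (2*pairsIn+count≡count² (P ∘ suc)) ⟩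
    s * s + (1 + 2 * s)         ≡⟨ square-suc s ⟩
    (1 + s) * (1 + s)           ∎
    where
    open ≡-Reasoning
    s = count (P ∘ suc)
    p = pairsIn (P ∘ suc)
    regroup : ∀ s p → 2 * (s + p) + (1 + s) ≡ (2 * p + s) + (1 + 2 * s)
    regroup = solve-∀
    square-suc : ∀ s → s * s + (1 + 2 * s) ≡ (1 + s) * (1 + s)
    square-suc = solve-∀

  pairsIn≡countC2 : ∀ {n} (P : Fin n → Bool) → pairsIn P ≡ count P C 2
  pairsIn≡countC2 P = ℕ.*-cancelˡ-≡ _ _ 2 (ℕ.+-cancelʳ-≡ (count P) _ _
    (trans (2*pairsIn+count≡count² P) (sym (2*[mC2]+m≡m*m (count P)))))

  ∣p∪⁅x⁆∣≡1+∣p∣ : ∀ {n} {x : Fin n} {p : Subset n} → x ∉ p → ∣ p ∪ ⁅ x ⁆ ∣ ≡ suc ∣ p ∣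
  ∣p∪⁅x⁆∣≡1+∣p∣ {x = zero}  {inside  ∷ p} x∉p = ⊥-elim (x∉p here)
  ∣p∪⁅x⁆∣≡1+∣p∣ {x = zero}  {outside ∷ p} x∉p = cong (suc ∘ ∣_∣) (∪-identityʳ p)
  ∣p∪⁅x⁆∣≡1+∣p∣ {x = suc x} {inside  ∷ p} x∉p = cong suc (∣p∪⁅x⁆∣≡1+∣p∣ (x∉p ∘ there))
  ∣p∪⁅x⁆∣≡1+∣p∣ {x = suc x} {outside ∷ p} x∉p = ∣p∪⁅x⁆∣≡1+∣p∣ (x∉p ∘ there)

  ∣p∣≡count : ∀ {n} (p : Subset n) → ∣ p ∣ ≡ count (λ u → ⌊ u ∈? p ⌋)
  ∣p∣≡count []            = refl
  ∣p∣≡count (inside  ∷ p) = cong suc (trans (∣p∣≡count p) (count-cong (sym ∘ ⌊⌋-map′ there drop-there ∘ (_∈? p))))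
  ∣p∣≡count (outside ∷ p) = trans (∣p∣≡count p) (count-cong (sym ∘ ⌊⌋-map′ there drop-there ∘ (_∈? p)))

  -- Walks and monochromatic components

  module _ {n r : ℕ} (c : Coloring n r) where

    Edge-sym : ∀ {i u v} → Edge c i u v → Edge c i v u
    Edge-sym {u = u} {v} (u≢v , uv≡i) = u≢v ∘ sym , trans (col-sym c v u) uv≡i

    Edge? : ∀ i u v → Dec (Edge c i u v)
    Edge? i u v = ¬? (u ≟ v) ×-dec (col c u v ≟ i)

    _++ʷ_ : ∀ {i u v w} → Walk c i u v → Walk c i v w → Walk c i u w
    here     ++ʷ q = q
    step e p ++ʷ q = step e (p ++ʷ q)

    reverseʷ : ∀ {i u v} → Walk c i u v → Walk c i v u
    reverseʷ here       = here
    reverseʷ (step e p) = reverseʷ p ++ʷ step (Edge-sym e) here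

    EdgeClosed : Fin r → (Fin n → Set) → Set
    EdgeClosed i P = ∀ {u v} → Edge c i u v → P u → P v

    walk-closed : ∀ {i P u v} → EdgeClosed i P → Walk c i u v → P u → P v
    walk-closed closed here       Pu = Pu
    walk-closed closed (step e p) Pu = walk-closed closed p (closed e Pu)

    component-closed : ∀ {i S} → IsComponent c i S → EdgeClosed i (_∈ S)
    component-closed S-comp {u} {v} e u∈S = IsComponent.closed S-comp u v u∈S e

    component-⊆ : ∀ {i S P u} → IsComponent c i S → EdgeClosed i P → u ∈ S → P u → ∀ {v} → v ∈ S → P v
    component-⊆ {u = u} S-comp P-closed u∈S Pu {v} v∈S =
      walk-closed P-closed (IsComponent.connected S-comp u v u∈S v∈S) Pu

    component-unique : ∀ {i A B u} → IsComponent c i A → IsComponent c i B → u ∈ A → u ∈ B → A ≡ B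
    component-unique A-comp B-comp u∈A u∈B =
      ⊆-antisym (component-⊆ A-comp (component-closed B-comp) u∈A u∈B)
                (component-⊆ B-comp (component-closed A-comp) u∈B u∈A)

    members : MonoComp c → Fin n → Bool
    members K u = ⌊ u ∈? compVerts K ⌋

    members-closed : ∀ K → EdgeClosed (compColour K) (T ∘ members K)
    members-closed (i , S , S-comp) e = fromWitness ∘ component-closed S-comp e ∘ toWitness

    members-⊆ : ∀ K {P u} → EdgeClosed (compColour K) (T ∘ P) → T (members K u) → T (P u) →
                ∀ v → T (members K v) → T (P v)
    members-⊆ (i , S , S-comp) P-closed u∈K Pu v v∈K =
      component-⊆ S-comp P-closed (toWitness u∈K) Pu (toWitness v∈K)

    module _ (i : Fin r) (u : Fin n) where

      record Reached : Set where
        field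
          verts : Subset n
          root  : u ∈ verts
          reach : ∀ {w} → w ∈ verts → Walk c i u w
      open Reached

      Exit : Subset n → Set
      Exit S = ∃₂ λ w v → w ∈ S × v ∉ S × Edge c i w v

      exit? : ∀ S → Dec (Exit S)
      exit? S = any? λ w → any? λ v → w ∈? S ×-dec ¬? (v ∈? S) ×-dec Edge? i w v

      extend : (R : Reached) → ∀ {w v} → w ∈ verts R → Edge c i w v → Reached
      extend R {w} {v} w∈R e = record
        { verts = verts R ∪ ⁅ v ⁆
        ; root  = p⊆p∪q ⁅ v ⁆ (root R)
        ; reach = λ {x} x∈R∪v → [ reach R , (λ x∈v → subst (Walk c i u) (sym (x∈⁅y⁆⇒x≡y v x∈v))
                                                                (reach R w∈R ++ʷ step e here)) ]′
                                  (x∈p∪q⁻ (verts R) ⁅ v ⁆ x∈R∪v)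
        }

      -- Each step adds a vertex, so n steps reach a set that no edge leaves.
      grow : (k : ℕ) (R : Reached) → n ≤ k + ∣ verts R ∣ → Σ Reached (¬_ ∘ Exit ∘ verts)
      grow k R n≤k+∣R∣ with exit? (verts R)
      grow k       R n≤k+∣R∣ | no ∄exit = R , ∄exit
      grow zero    R n≤∣R∣   | yes (w , v , w∈R , v∉R , e) = ⊥-elim (ℕ.1+n≰n
        (subst (_≤ ∣ verts R ∣) (∣p∪⁅x⁆∣≡1+∣p∣ v∉R) (≤-trans (∣p∣≤n (verts R ∪ ⁅ v ⁆)) n≤∣R∣)))
      grow (suc k) R n≤k+∣R∣ | yes (w , v , w∈R , v∉R , e) =
        grow k (extend R w∈R e)
          (subst (n ≤_) (trans (sym (ℕ.+-suc k _)) (cong (k +_) (sym (∣p∪⁅x⁆∣≡1+∣p∣ v∉R)))) n≤k+∣R∣)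

      start : Reached
      start = record { verts = ⁅ u ⁆ ; root = x∈⁅x⁆ u
                     ; reach = λ w∈u → subst (Walk c i u) (sym (x∈⁅y⁆⇒x≡y u w∈u)) here }

      closure : Σ Reached (¬_ ∘ Exit ∘ verts)
      closure = grow n start (m≤m+n n _)

      componentOf : MonoComp c
      componentOf = i , verts R , record
        { nonempty  = u , root R
        ; connected = λ x y x∈R y∈R → reverseʷ (reach R x∈R) ++ʷ reach R y∈R
        ; closed    = λ x y x∈R e → closed x∈R e
        }
        where
        R = proj₁ closure
        closed : ∀ {x y} → x ∈ verts R → Edge c i x y → y ∈ verts R
        closed {x} {y} x∈R e with y ∈? verts R
        ... | yes y∈R = y∈R
        ... | no  y∉R = ⊥-elim (proj₂ closure (x , y , x∈R , y∉R , e))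

      componentOf-member : T (members componentOf u)
      componentOf-member = fromWitness (root (proj₁ closure))

    edgesIn : Fin r → (Fin n → Bool) → ℕ
    edgesIn i P = pairsWith (λ u v → P u ∧ P v ∧ ⌊ col c u v ≟ i ⌋)

    edgesIn-cong : ∀ {i P Q} → (∀ u → P u ≡ Q u) → edgesIn i P ≡ edgesIn i Q
    edgesIn-cong P≗Q = pairsWith-cong λ u v → cong₂ (λ a b → a ∧ b ∧ _) (P≗Q u) (P≗Q v)

    edgesIn-none : ∀ {i P} → (∀ u → ¬ T (P u)) → edgesIn i P ≡ 0
    edgesIn-none ¬P = pairsWith-none λ u v → ¬P u ∘ proj₁ ∘ Equivalence.to T-∧

    edgesIn≤pairsIn : ∀ i P → edgesIn i P ≤ pairsIn P
    edgesIn≤pairsIn i P = pairsWith-mono-≤ λ u v → forget (P u) (P v) _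
      where
      forget : ∀ a b e → T (a ∧ b ∧ e) → T (a ∧ b)
      forget true true e _ = tt

    edgesIn-split : ∀ {i} P K → (∀ u → T (K u) → T (P u)) → EdgeClosed i (T ∘ K) →
                    edgesIn i P ≡ edgesIn i (P ∖ K) + edgesIn i K
    edgesIn-split {i} P K K⊆P K-closed = pairsWith-split λ u v u≺v →
      𝟙-split (P u) (P v) (K u) (K v) _ (K⊆P u) (K⊆P v)
        (λ e → K-closed (edge u≺v e)) (λ e → K-closed (Edge-sym (edge u≺v e)))
      where
      edge : ∀ {u v} → T (u ≺ v) → T ⌊ col c u v ≟ i ⌋ → Edge c i u v
      edge u≺v e = ≺⇒≢ u≺v , toWitness e

    edgesIn-cover : ∀ i P (Qs : List (Fin n → Bool)) →
                    (∀ {u v} → Edge c i u v → T (P u) → T (P v) → Any (λ Q → T (Q u) × T (Q v)) Qs) →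
                    edgesIn i P ≤ sum (map (edgesIn i) Qs)
    edgesIn-cover i P Qs cover = begin
      edgesIn i P                                          ≤⟨ ∑-mono-≤ (λ u → ∑-mono-≤ (covered-pair u)) ⟩
      ∑[ u < n ] ∑[ v < n ] sum (map (λ Q → pair Q u v) Qs)  ≡⟨ sum-cong-≗ (λ u → sum-map-∑ (λ Q → pair Q u) Qs) ⟨
      ∑[ u < n ] sum (map (λ Q → ∑ (pair Q u)) Qs)         ≡⟨ sum-map-∑ (λ Q u → ∑ (pair Q u)) Qs ⟨
      sum (map (edgesIn i) Qs)                             ∎
      where
      open ≤-Reasoning
      pair : (Fin n → Bool) → Fin n → Fin n → ℕ
      pair Q u v = 𝟙 (u ≺ v ∧ Q u ∧ Q v ∧ ⌊ col c u v ≟ i ⌋)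
      both : ∀ {a b} → T a × T b → 1 ≤ 𝟙 (a ∧ b ∧ true)
      both {true} {true} _ = ≤-refl
      covered-pair : ∀ u v → pair P u v ≤ sum (map (λ Q → pair Q u v) Qs)
      covered-pair u v with u ≺ v in u≺v | P u in Pu | P v in Pv | col c u v ≟ i
      ... | false | _     | _     | _         = z≤n
      ... | true  | false | _     | _         = z≤n
      ... | true  | true  | false | _         = z≤n
      ... | true  | true  | true  | no  _     = z≤n
      ... | true  | true  | true  | yes uv≡i  = 0<sum-map (Any.map both
        (cover (≺⇒≢ (subst T (sym u≺v) tt) , uv≡i) (subst T (sym Pu) tt) (subst T (sym Pv) tt)))

    vsize≡count : ∀ K → vsize K ≡ count (members K)
    vsize≡count K = ∣p∣≡count (compVerts K)

    esize≡edgesIn : ∀ K → esize K ≡ edgesIn (compColour K) (members K)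
    esize≡edgesIn K = trans (sum-map-tabulate {n = n} id _) (sum-cong-≗ {n} λ u → sum-map-tabulate {n = n} id _)

    esize-bound : ∀ K → esize K * (n * n) ≤ (vsize K * vsize K) * (n C 2)
    esize-bound K = ≤-trans (ℕ.*-monoˡ-≤ (n * n) esize≤vsizeC2) ([mC2]*[n*n]≤[m*m]*[nC2] (∣p∣≤n (compVerts K)))
      where
      esize≤vsizeC2 : esize K ≤ vsize K C 2
      esize≤vsizeC2 = begin
        esize K                              ≡⟨ esize≡edgesIn K ⟩
        edgesIn (compColour K) (members K)  ≤⟨ edgesIn≤pairsIn (compColour K) (members K) ⟩
        pairsIn (members K)                  ≡⟨ pairsIn≡countC2 (members K) ⟩
        count (members K) C 2                ≡⟨ cong (_C 2) (vsize≡count K) ⟨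
        vsize K C 2                          ∎
        where open ≤-Reasoning

    -- Decomposing a closed vertex set into components

    ∖-closed : ∀ {i P K} → EdgeClosed i (T ∘ P) → EdgeClosed i (T ∘ K) → EdgeClosed i (T ∘ (P ∖ K))
    ∖-closed P-closed K-closed e P∖Ku with Equivalence.to T-∧ P∖Ku
    ... | Pu , ¬Ku = Equivalence.from T-∧ (P-closed e Pu , T-not⁺ (T-not⁻ ¬Ku ∘ K-closed (Edge-sym e)))

    ComponentList : ℕ → ℕ → Set
    ComponentList a b = Σ (List (MonoComp c)) λ L → sum (map vsize L) ≡ a × sum (map esize L) ≡ b

    decompose : ∀ i k P → count P ≤ k → EdgeClosed i (T ∘ P) → ComponentList (count P) (edgesIn i P)
    decompose i k P |P|≤k P-closed with any? (T? ∘ P)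
    ... | no ∄u = [] , sym (count-none ¬P) , sym (edgesIn-none ¬P)
      where
      ¬P : ∀ u → ¬ T (P u)
      ¬P u Pu = ∄u (u , Pu)
    decompose i zero    P |P|≤0 P-closed | yes (u , Pu) with () ← ≤-trans (0<count P Pu) |P|≤0
    decompose i (suc k) P |P|≤k P-closed | yes (u , Pu) =
      K ∷ L , trans (cong₂ _+_ (vsize≡count K) |L|≡) (trans (+-comm (count (members K)) _) (sym |P|≡)) ,
              trans (cong₂ _+_ (esize≡edgesIn K) ‖L‖≡) (trans (+-comm (edgesIn i (members K)) _) (sym ‖P‖≡))
      where
      K  = componentOf i u
      u∈K = componentOf-member i u
      K⊆P : ∀ v → T (members K v) → T (P v)
      K⊆P = members-⊆ K P-closed u∈K Pu
      |P|≡ : count P ≡ count (P ∖ members K) + count (members K)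
      |P|≡ = count-split P (members K) K⊆P
      ‖P‖≡ : edgesIn i P ≡ edgesIn i (P ∖ members K) + edgesIn i (members K)
      ‖P‖≡ = edgesIn-split P (members K) K⊆P (members-closed K)
      |P∖K|≤k : count (P ∖ members K) ≤ k
      |P∖K|≤k = ℕ.+-cancelʳ-≤ 1 _ _ (begin
        count (P ∖ members K) + 1                 ≤⟨ ℕ.+-monoʳ-≤ _ (0<count (members K) u∈K) ⟩
        count (P ∖ members K) + count (members K) ≡⟨ |P|≡ ⟨
        count P                                   ≤⟨ |P|≤k ⟩
        suc k                                     ≡⟨ +-comm 1 k ⟩
        k + 1                                     ∎)
        where open ≤-Reasoning
      rest = decompose i k (P ∖ members K) |P∖K|≤k (∖-closed P-closed (members-closed K))
      L = proj₁ rest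
      |L|≡ = proj₁ (proj₂ rest)
      ‖L‖≡ = proj₂ (proj₂ rest)

    concat-componentLists : ∀ {m} (a b : Fin m → ℕ) → (∀ j → ComponentList (a j) (b j)) →
                            ComponentList (∑ a) (∑ b)
    concat-componentLists {zero}  a b Ls = [] , refl , refl
    concat-componentLists {suc m} a b Ls with Ls zero | concat-componentLists (a ∘ suc) (b ∘ suc) (Ls ∘ suc)
    ... | L₀ , |L₀| , ‖L₀‖ | L , |L| , ‖L‖ =
      L₀ ++ L , trans (sum-map-++ vsize L₀ L) (cong₂ _+_ |L₀| |L|)
              , trans (sum-map-++ esize L₀ L) (cong₂ _+_ ‖L₀‖ ‖L‖)

    membersAt : MonoComp c → Fin r → Fin n → Bool
    membersAt K i u = ⌊ compColour K ≟ i ⌋ ∧ members K u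

    ∑-membersAt : ∀ K (f : Fin r → (Fin n → Bool) → ℕ) →
                  (∀ {i P Q} → (∀ u → P u ≡ Q u) → f i P ≡ f i Q) → (∀ i → f i (λ _ → false) ≡ 0) →
                  ∑ (λ i → f i (membersAt K i)) ≡ f (compColour K) (members K)
    ∑-membersAt K f f-cong f-∅ = trans
      (∑-single (compColour K) λ i j≢i →
        trans (f-cong λ u → cong (_∧ members K u) (⌊≟⌋-other j≢i)) (f-∅ i))
      (f-cong λ u → cong (_∧ members K u) (⌊≟⌋-self (compColour K)))

    vsize≡∑count : ∀ K → vsize K ≡ ∑ (λ i → count (membersAt K i))
    vsize≡∑count K = trans (vsize≡count K)
      (sym (∑-membersAt K (λ _ → count) count-cong (λ _ → count-none {n} {λ _ → false} λ _ ())))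

    esize≡∑edgesIn : ∀ K → esize K ≡ ∑ (λ i → edgesIn i (membersAt K i))
    esize≡∑edgesIn K = trans (esize≡edgesIn K)
      (sym (∑-membersAt K edgesIn edgesIn-cong (λ j → edgesIn-none {j} {λ _ → false} λ _ ())))

    membersAt-closed : ∀ K i → EdgeClosed i (T ∘ membersAt K i)
    membersAt-closed K i e Ku with Equivalence.to T-∧ Ku
    ... | j≟i , u∈K with toWitness {a? = compColour K ≟ i} j≟i
    ... | refl = Equivalence.from T-∧ (j≟i , members-closed K e u∈K)

    distinct⇒disjoint : ∀ i {K D} → DistinctComp K D → Disjoint (membersAt K i) (membersAt D i)
    distinct⇒disjoint i {j , A , A-comp} {j′ , B , B-comp} K≠D u Ku Du
      with Equivalence.to T-∧ Ku | Equivalence.to T-∧ Du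
    ... | j≟i , u∈A | j′≟i , u∈B with toWitness {a? = j ≟ i} j≟i | toWitness {a? = j′ ≟ i} j′≟i
    ... | refl | refl = K≠D (refl , component-unique A-comp B-comp (toWitness u∈A) (toWitness u∈B))

    covered : List (MonoComp c) → Fin r → Fin n → Bool
    covered X i u = any (λ K → membersAt K i u) X

    covered-closed : ∀ X i → EdgeClosed i (T ∘ covered X i)
    covered-closed X i e Xu = any⁺ _ (Any.map (λ {K} → membersAt-closed K i e) (any⁻ _ X Xu))

    uncovered : List (MonoComp c) → Fin r → Fin n → Bool
    uncovered X i u = not (covered X i u)

    uncovered-closed : ∀ X i → EdgeClosed i (T ∘ uncovered X i)
    uncovered-closed X i e ¬Xu = T-not⁺ (T-not⁻ ¬Xu ∘ covered-closed X i (Edge-sym e))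

    colour-class-vertices : ∀ X → AllPairs DistinctComp X → ∀ i →
                            count (uncovered X i) + sum (map (λ K → count (membersAt K i)) X) ≤ n
    colour-class-vertices X X-distinct i =
      subst (λ s → count (uncovered X i) + s ≤ n) (sym (cong sum (map-∘ X)))
        (count-disjoint (uncovered X i ∷ map (λ K → membersAt K i) X)
          (All.map⁺ (All.tabulate λ K∈X u ¬Xu Ku → T-not⁻ ¬Xu (any⁺ _ (Any.map (λ { refl → Ku }) K∈X)))
           ∷ AllPairs.map⁺ {f = λ K → membersAt K i}
               (AllPairs.map (λ {K} {D} → distinct⇒disjoint i {K} {D}) X-distinct)))

    colour-class-edges : ∀ X i →
      edgesIn i (λ _ → true) ≤ edgesIn i (uncovered X i) + sum (map (λ K → edgesIn i (membersAt K i)) X)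
    colour-class-edges X i =
      subst (λ s → edgesIn i (λ _ → true) ≤ edgesIn i (uncovered X i) + s) (sym (cong sum (map-∘ X)))
        (edgesIn-cover i (λ _ → true) (uncovered X i ∷ map (λ K → membersAt K i) X) cover)
      where
      cover : ∀ {u v} → Edge c i u v → ⊤ → ⊤ →
              Any (λ Q → T (Q u) × T (Q v)) (uncovered X i ∷ map (λ K → membersAt K i) X)
      cover {u} e _ _ with T? (covered X i u)
      ... | yes Xu = there (Any.map⁺ (Any.map (λ {K} Ku → Ku , membersAt-closed K i e Ku) (any⁻ _ X Xu)))
      ... | no ¬Xu = here (T-not⁺ ¬Xu , uncovered-closed X i e (T-not⁺ ¬Xu))

    ∑-edgesIn-all : ∑[ i < r ] edgesIn i (λ _ → true) ≡ pairsIn {n} (λ _ → true)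
    ∑-edgesIn-all = begin
      ∑[ i < r ] ∑[ u < n ] ∑[ v < n ] edge i u v  ≡⟨ ∑-comm (λ i u → ∑[ v < n ] edge i u v) ⟩
      ∑[ u < n ] ∑[ i < r ] ∑[ v < n ] edge i u v  ≡⟨ sum-cong-≗ (λ u → ∑-comm (λ i v → edge i u v)) ⟩
      ∑[ u < n ] ∑[ v < n ] ∑[ i < r ] edge i u v  ≡⟨ sum-cong-≗ (λ u → sum-cong-≗ λ v → one-colour (u ≺ v) (col c u v)) ⟩
      pairsIn {n} (λ _ → true)                     ∎
      where
      open ≡-Reasoning
      edge : Fin r → Fin n → Fin n → ℕ
      edge i u v = 𝟙 (u ≺ v ∧ ⌊ col c u v ≟ i ⌋)
      one-colour : ∀ b j → ∑[ i < r ] 𝟙 (b ∧ ⌊ j ≟ i ⌋) ≡ 𝟙 (b ∧ true)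
      one-colour b j = trans
        (∑-single j λ i j≢i → trans (cong (λ x → 𝟙 (b ∧ x)) (⌊≟⌋-other j≢i)) (cong 𝟙 (∧-zeroʳ b)))
        (cong (λ x → 𝟙 (b ∧ x)) (⌊≟⌋-self j))

    vertex-budget : ∀ X → AllPairs DistinctComp X → ∑[ i < r ] count (uncovered X i) + sum (map vsize X) ≤ r * n
    vertex-budget X X-distinct = begin
      ∑[ i < r ] count (uncovered X i) + sum (map vsize X)
        ≡⟨ cong (∑[ i < r ] count (uncovered X i) +_)
                (trans (sum-map-cong X vsize≡∑count) (sum-map-∑ (λ K i → count (membersAt K i)) X)) ⟩
      ∑[ i < r ] count (uncovered X i) + ∑[ i < r ] sum (map (λ K → count (membersAt K i)) X)
        ≡⟨ ∑-distrib-+ (λ i → count (uncovered X i)) (λ i → sum (map (λ K → count (membersAt K i)) X)) ⟨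
      ∑[ i < r ] (count (uncovered X i) + sum (map (λ K → count (membersAt K i)) X))
        ≤⟨ ∑-mono-≤ (colour-class-vertices X X-distinct) ⟩
      ∑[ i < r ] n
        ≡⟨ ∑-const r n ⟩
      r * n ∎
      where open ≤-Reasoning

    edge-budget : ∀ X → n C 2 ≤ ∑[ i < r ] edgesIn i (uncovered X i) + sum (map esize X)
    edge-budget X = begin
      n C 2
        ≡⟨ trans (cong (_C 2) (sym (count-true n))) (sym (pairsIn≡countC2 {n} (λ _ → true))) ⟩
      pairsIn {n} (λ _ → true)
        ≡⟨ ∑-edgesIn-all ⟨
      ∑[ i < r ] edgesIn i (λ _ → true)
        ≤⟨ ∑-mono-≤ (colour-class-edges X) ⟩
      ∑[ i < r ] (edgesIn i (uncovered X i) + sum (map (λ K → edgesIn i (membersAt K i)) X))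
        ≡⟨ ∑-distrib-+ (λ i → edgesIn i (uncovered X i))
                       (λ i → sum (map (λ K → edgesIn i (membersAt K i)) X)) ⟩
      ∑[ i < r ] edgesIn i (uncovered X i) + ∑[ i < r ] sum (map (λ K → edgesIn i (membersAt K i)) X)
        ≡⟨ cong (∑[ i < r ] edgesIn i (uncovered X i) +_)
                (trans (sum-map-cong X esize≡∑edgesIn) (sum-map-∑ (λ K i → edgesIn i (membersAt K i)) X)) ⟨
      ∑[ i < r ] edgesIn i (uncovered X i) + sum (map esize X) ∎
      where open ≤-Reasoning

    remaining-components : ∀ X → AllPairs DistinctComp X →
      Σ (List (MonoComp c)) λ L → n C 2 ≤ sum (map esize L) + sum (map esize X)
                                × sum (map vsize L) + sum (map vsize X) ≤ r * n
    remaining-components X X-distinct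
      with concat-componentLists (count ∘ uncovered X) (λ i → edgesIn i (uncovered X i))
             (λ i → decompose i n (uncovered X i) (count≤n _) (uncovered-closed X i))
    ... | L , |L| , ‖L‖ = L , subst (λ s → n C 2 ≤ s + sum (map esize X)) (sym ‖L‖) (edge-budget X)
                            , subst (λ s → s + sum (map vsize X) ≤ r * n) (sym |L|) (vertex-budget X X-distinct)

open Combinatorics using (remaining-components; esize-bound; 0<nC2; sum-map-*ʳ)
open import Data.Nat.Combinatorics using (_C_)
open import Data.List.Relation.Unary.AllPairs using (AllPairs)
open import Data.Product using (_,_)

open import Data.Nat as ℕ using (ℕ; _≥_)
import Data.Nat.Properties as ℕ
open import Data.Nat.ListAction using (sum)
open import Data.List using (List; []; _∷_; map; length)
open import Data.Integer as ℤ using (+_)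
import Data.Integer.Properties as ℤ
open import Data.Nat.Coprimality using (1-coprimeTo)
import Data.Nat.Coprimality as Coprimality
open import Data.Rational
  using (ℚ; mkℚ; 0ℚ; 1ℚ; _+_; _*_; _-_; -_; _≤_; _<_; _⊔_; *≤*; *<*; _≟_;
         Positive; nonNegative; nonPositive; positive)
open import Data.Rational.Properties
open import Data.Sum using (inj₁; inj₂)
open import Data.Empty using (⊥-elim)
open import Level using (0ℓ)
open import Relation.Binary using (tri<; tri≈; tri>)
open import Relation.Binary.PropositionalEquality
open import Relation.Nullary.Decidable using (dec⇒maybe)
import Tactic.RingSolver.Core.AlmostCommutativeRing as ACR
open import Tactic.RingSolver using (solve-∀)

-- Rational estimates

ℚ-ring : ACR.AlmostCommutativeRing 0ℓ 0ℓ
ℚ-ring = ACR.fromCommutativeRing +-*-commutativeRing λ p → dec⇒maybe (0ℚ ≟ p)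

ℕ→ℚ≡mkℚ : ∀ k → ℕ→ℚ k ≡ mkℚ (+ k) 0 (Coprimality.sym (1-coprimeTo k))
ℕ→ℚ≡mkℚ k = normalize-coprime (Coprimality.sym (1-coprimeTo k))

ℕ→ℚ-homo-+ : ∀ a b → ℕ→ℚ (a ℕ.+ b) ≡ ℕ→ℚ a + ℕ→ℚ b
ℕ→ℚ-homo-+ a b rewrite ℕ→ℚ≡mkℚ a | ℕ→ℚ≡mkℚ b =
  sym (cong (λ t → t Data.Rational./ 1) (cong₂ ℤ._+_ (ℤ.*-identityʳ (+ a)) (ℤ.*-identityʳ (+ b))))

ℕ→ℚ-homo-* : ∀ a b → ℕ→ℚ (a ℕ.* b) ≡ ℕ→ℚ a * ℕ→ℚ b
ℕ→ℚ-homo-* a b rewrite ℕ→ℚ≡mkℚ a | ℕ→ℚ≡mkℚ b = cong (λ t → t Data.Rational./ 1) (ℤ.pos-* a b)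

ℕ→ℚ-mono-≤ : ∀ {a b} → a ℕ.≤ b → ℕ→ℚ a ≤ ℕ→ℚ b
ℕ→ℚ-mono-≤ {a} {b} a≤b rewrite ℕ→ℚ≡mkℚ a | ℕ→ℚ≡mkℚ b =
  *≤* (subst₂ ℤ._≤_ (sym (ℤ.*-identityʳ (+ a))) (sym (ℤ.*-identityʳ (+ b))) (ℤ.+≤+ a≤b))

ℕ→ℚ-mono-< : ∀ {a b} → a ℕ.< b → ℕ→ℚ a < ℕ→ℚ b
ℕ→ℚ-mono-< {a} {b} a<b rewrite ℕ→ℚ≡mkℚ a | ℕ→ℚ≡mkℚ b =
  *<* (subst₂ ℤ._<_ (sym (ℤ.*-identityʳ (+ a))) (sym (ℤ.*-identityʳ (+ b))) (ℤ.+<+ a<b))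

ℕ→ℚ-nonNeg : ∀ k → 0ℚ ≤ ℕ→ℚ k
ℕ→ℚ-nonNeg k = ℕ→ℚ-mono-≤ {0} {k} ℕ.z≤n

*-nonNeg : ∀ {p q} → 0ℚ ≤ p → 0ℚ ≤ q → 0ℚ ≤ p * q
*-nonNeg {p} {q} 0≤p 0≤q = nonNegative⁻¹ (p * q) {{nonNeg*nonNeg⇒nonNeg p {{nonNegative 0≤p}} q {{nonNegative 0≤q}}}}

*-monoˡ-≤-0≤ : ∀ {r p q} → 0ℚ ≤ r → p ≤ q → r * p ≤ r * q
*-monoˡ-≤-0≤ {r} 0≤r = *-monoˡ-≤-nonNeg r {{nonNegative 0≤r}}

*-monoʳ-≤-0≤ : ∀ {r p q} → 0ℚ ≤ r → p ≤ q → p * r ≤ q * r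
*-monoʳ-≤-0≤ {r} 0≤r = *-monoʳ-≤-nonNeg r {{nonNegative 0≤r}}

*-mono-≤-0≤ : ∀ {p q r s} → 0ℚ ≤ p → 0ℚ ≤ r → p ≤ q → r ≤ s → p * r ≤ q * s
*-mono-≤-0≤ 0≤p 0≤r p≤q r≤s = ≤-trans (*-monoʳ-≤-0≤ 0≤r p≤q) (*-monoˡ-≤-0≤ (≤-trans 0≤p p≤q) r≤s)

square-nonNeg : ∀ p → 0ℚ ≤ p * p
square-nonNeg p with ≤-total 0ℚ p
... | inj₁ 0≤p = *-nonNeg 0≤p 0≤p
... | inj₂ p≤0 = nonNegative⁻¹ (p * p) {{nonPos*nonPos⇒nonPos p {{nonPositive p≤0}} p {{nonPositive p≤0}}}}

square-mono-≤ : ∀ {p q} → 0ℚ ≤ p → p ≤ q → p * p ≤ q * q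
square-mono-≤ 0≤p p≤q = *-mono-≤-0≤ 0≤p 0≤p p≤q p≤q

square-cancel-≤ : ∀ {p q} → 0ℚ ≤ q → p * p ≤ q * q → p ≤ q
square-cancel-≤ {p} {q} 0≤q p²≤q² with <-cmp p q
... | tri< p<q _ _ = <⇒≤ p<q
... | tri≈ _ p≡q _ = ≤-reflexive p≡q
... | tri> _ _ q<p = ⊥-elim (<-irrefl refl (<-≤-trans (≤-<-trans q²≤qp qp<p²) p²≤q²))
  where
  0<p = ≤-<-trans 0≤q q<p
  q²≤qp : q * q ≤ q * p
  q²≤qp = *-monoˡ-≤-0≤ 0≤q (<⇒≤ q<p)
  qp<p² : q * p < p * p
  qp<p² = *-monoˡ-<-pos p {{positive 0<p}} q<p

p+q≤r⇒p≤r-q : ∀ {p q r} → p + q ≤ r → p ≤ r - q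
p+q≤r⇒p≤r-q {p} {q} {r} p+q≤r = begin
  p            ≡⟨ cancel p q ⟩
  (p + q) - q  ≤⟨ +-monoˡ-≤ (- q) p+q≤r ⟩
  r - q        ∎
  where
  open ≤-Reasoning
  cancel : ∀ p q → p ≡ (p + q) - q
  cancel = solve-∀ ℚ-ring

p≤q+r⇒p-r≤q : ∀ {p q r} → p ≤ q + r → p - r ≤ q
p≤q+r⇒p-r≤q {p} {q} {r} p≤q+r = begin
  p - r        ≤⟨ +-monoˡ-≤ (- r) p≤q+r ⟩
  (q + r) - r  ≡⟨ cancel q r ⟨
  q            ∎
  where
  open ≤-Reasoning
  cancel : ∀ q r → q ≡ (q + r) - r
  cancel = solve-∀ ℚ-ring

sum≤length*bound : ∀ {A : Set} (f : A → ℕ) {t} (xs : List A) → (∀ x → ℕ→ℚ (f x) ≤ t) →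
                   ℕ→ℚ (sum (map f xs)) ≤ ℕ→ℚ (length xs) * t
sum≤length*bound f {t} []       f≤t = ≤-reflexive (sym (*-zeroˡ t))
sum≤length*bound f {t} (x ∷ xs) f≤t = begin
  ℕ→ℚ (f x ℕ.+ sum (map f xs))     ≡⟨ ℕ→ℚ-homo-+ (f x) _ ⟩
  ℕ→ℚ (f x) + ℕ→ℚ (sum (map f xs)) ≤⟨ +-mono-≤ (f≤t x) (sum≤length*bound f xs f≤t) ⟩
  t + ℕ→ℚ (length xs) * t          ≡⟨ distrib t (ℕ→ℚ (length xs)) ⟩
  (1ℚ + ℕ→ℚ (length xs)) * t       ≡⟨ cong (_* t) (ℕ→ℚ-homo-+ 1 (length xs)) ⟨
  ℕ→ℚ (1 ℕ.+ length xs) * t        ∎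
  where
  open ≤-Reasoning
  distrib : ∀ t l → t + l * t ≡ (1ℚ + l) * t
  distrib = solve-∀ ℚ-ring

*-square-bound : ∀ {M x X y Y} → 0ℚ ≤ M → 0ℚ ≤ y → 0ℚ ≤ Y →
                 x * x ≤ M * (y * y) → X * X ≤ M * (Y * Y) → x * X ≤ M * (y * Y)
*-square-bound {M} {x} {X} {y} {Y} 0≤M 0≤y 0≤Y x²≤My² X²≤MY² =
  square-cancel-≤ (*-nonNeg 0≤M (*-nonNeg 0≤y 0≤Y)) (begin
    (x * X) * (x * X)              ≡⟨ regroupˡ x X ⟩
    (x * x) * (X * X)              ≤⟨ *-mono-≤-0≤ (square-nonNeg x) (square-nonNeg X) x²≤My² X²≤MY² ⟩
    (M * (y * y)) * (M * (Y * Y))  ≡⟨ regroupʳ M y Y ⟩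
    (M * (y * Y)) * (M * (y * Y))  ∎)
  where
  open ≤-Reasoning
  regroupˡ : ∀ x X → (x * X) * (x * X) ≡ (x * x) * (X * X)
  regroupˡ = solve-∀ ℚ-ring
  regroupʳ : ∀ M y Y → (M * (y * y)) * (M * (Y * Y)) ≡ (M * (y * Y)) * (M * (y * Y))
  regroupʳ = solve-∀ ℚ-ring

-- Square-root-free form of: if a ≤ √M b termwise, then Σ a ≤ √M Σ b.
sum-square-bound : ∀ {A : Set} (a b : A → ℕ) {M} (xs : List A) → 0ℚ ≤ M →
                   (∀ x → ℕ→ℚ (a x) * ℕ→ℚ (a x) ≤ M * (ℕ→ℚ (b x) * ℕ→ℚ (b x))) →
                   ℕ→ℚ (sum (map a xs)) * ℕ→ℚ (sum (map a xs))
                   ≤ M * (ℕ→ℚ (sum (map b xs)) * ℕ→ℚ (sum (map b xs)))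
sum-square-bound a b {M} []       0≤M bound = *-nonNeg 0≤M ≤-refl
sum-square-bound a b {M} (x ∷ xs) 0≤M bound
  rewrite ℕ→ℚ-homo-+ (a x) (sum (map a xs)) | ℕ→ℚ-homo-+ (b x) (sum (map b xs)) = begin
    (u + U) * (u + U)                               ≡⟨ expand u U ⟩
    u * u + (u * U + u * U) + U * U                 ≤⟨ +-mono-≤ (+-mono-≤ (bound x) (+-mono-≤ cross cross)) IH ⟩
    M * (v * v) + (M * (v * V) + M * (v * V)) + M * (V * V)  ≡⟨ factor M v V ⟩
    M * ((v + V) * (v + V))                         ∎
  where
  open ≤-Reasoning
  u = ℕ→ℚ (a x)
  U = ℕ→ℚ (sum (map a xs))
  v = ℕ→ℚ (b x)
  V = ℕ→ℚ (sum (map b xs))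
  IH = sum-square-bound a b xs 0≤M bound
  cross : u * U ≤ M * (v * V)
  cross = *-square-bound {x = u} {U} 0≤M (ℕ→ℚ-nonNeg (b x)) (ℕ→ℚ-nonNeg (sum (map b xs))) (bound x) IH
  expand : ∀ u U → (u + U) * (u + U) ≡ u * u + (u * U + u * U) + U * U
  expand = solve-∀ ℚ-ring
  factor : ∀ M v V → M * (v * v) + (M * (v * V) + M * (v * V)) + M * (V * V) ≡ M * ((v + V) * (v + V))
  factor = solve-∀ ℚ-ring

density-square-bound : ∀ {e v n N z} → 0ℚ ≤ e → 0ℚ ≤ N →
                       e * (n * n) ≤ (v * v) * N → e ≤ z * N → (e * n) * (e * n) ≤ (z * (N * N)) * (v * v)
density-square-bound {e} {v} {n} {N} {z} 0≤e 0≤N en²≤v²N e≤zN = begin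
  (e * n) * (e * n)        ≡⟨ regroupˡ e n ⟩
  e * (e * (n * n))        ≤⟨ *-monoˡ-≤-0≤ 0≤e en²≤v²N ⟩
  e * ((v * v) * N)        ≤⟨ *-monoʳ-≤-0≤ (*-nonNeg (square-nonNeg v) 0≤N) e≤zN ⟩
  (z * N) * ((v * v) * N)  ≡⟨ regroupʳ z N v ⟩
  (z * (N * N)) * (v * v)  ∎
  where
  open ≤-Reasoning
  regroupˡ : ∀ e n → (e * n) * (e * n) ≡ e * (e * (n * n))
  regroupˡ = solve-∀ ℚ-ring
  regroupʳ : ∀ z N v → (z * N) * ((v * v) * N) ≡ (z * (N * N)) * (v * v)
  regroupʳ = solve-∀ ℚ-ring

ratio-bound : ∀ {a e v s z N n} → 0ℚ < N → 0ℚ < n → 0ℚ ≤ a → 0ℚ ≤ v → 0ℚ ≤ z →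
              a * N ≤ e → v ≤ s * n → (e * n) * (e * n) ≤ (z * (N * N)) * (v * v) → a * a ≤ z * (s * s)
ratio-bound {a} {e} {v} {s} {z} {N} {n} 0<N 0<n 0≤a 0≤v 0≤z aN≤e v≤sn [en]²≤zN²v² =
  *-cancelʳ-≤-pos ((N * n) * (N * n)) {{pos*pos⇒pos (N * n) {{Nn>0}} (N * n) {{Nn>0}}}} (begin
    (a * a) * ((N * n) * (N * n))        ≡⟨ regroupˡ a N n ⟩
    ((a * N) * n) * ((a * N) * n)        ≤⟨ square-mono-≤ (*-nonNeg (*-nonNeg 0≤a 0≤N) 0≤n) (*-monoʳ-≤-0≤ 0≤n aN≤e) ⟩
    (e * n) * (e * n)                    ≤⟨ [en]²≤zN²v² ⟩
    (z * (N * N)) * (v * v)              ≤⟨ *-monoˡ-≤-0≤ (*-nonNeg 0≤z (square-nonNeg N)) (square-mono-≤ 0≤v v≤sn) ⟩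
    (z * (N * N)) * ((s * n) * (s * n))  ≡⟨ regroupʳ z N s n ⟩
    (z * (s * s)) * ((N * n) * (N * n))  ∎)
  where
  open ≤-Reasoning
  0≤N = <⇒≤ 0<N
  0≤n = <⇒≤ 0<n
  Nn>0 : Positive (N * n)
  Nn>0 = pos*pos⇒pos N {{positive 0<N}} n {{positive 0<n}}
  regroupˡ : ∀ a N n → (a * a) * ((N * n) * (N * n)) ≡ ((a * N) * n) * ((a * N) * n)
  regroupˡ = solve-∀ ℚ-ring
  regroupʳ : ∀ z N s n → (z * (N * N)) * ((s * n) * (s * n)) ≡ (z * (s * s)) * ((N * n) * (N * n))
  regroupʳ = solve-∀ ℚ-ring

ℕ→ℚ-mono-≤-+ : ∀ {a b c} → a ℕ.≤ b ℕ.+ c → ℕ→ℚ a ≤ ℕ→ℚ b + ℕ→ℚ c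
ℕ→ℚ-mono-≤-+ {a} {b} {c} a≤b+c = subst (ℕ→ℚ a ≤_) (ℕ→ℚ-homo-+ b c) (ℕ→ℚ-mono-≤ a≤b+c)

ℕ→ℚ-mono-≤-+-* : ∀ {a b c d} → a ℕ.+ b ℕ.≤ c ℕ.* d → ℕ→ℚ a + ℕ→ℚ b ≤ ℕ→ℚ c * ℕ→ℚ d
ℕ→ℚ-mono-≤-+-* {a} {b} {c} {d} a+b≤cd =
  subst₂ _≤_ (ℕ→ℚ-homo-+ a b) (ℕ→ℚ-homo-* c d) (ℕ→ℚ-mono-≤ a+b≤cd)

budget-bound : ∀ {x r γ z n N EL VL EX VX} → 0ℚ < N → 0ℚ < n → 0ℚ ≤ EL → 0ℚ ≤ VL → 0ℚ < z →
               N ≤ EL + EX → EX ≤ x * (z * N) → VL + VX ≤ r * n → γ * n ≤ VX →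
               (EL * n) * (EL * n) ≤ (z * (N * N)) * (VL * VL) →
               ((1ℚ - x * z) ⊔ 0ℚ) * ((1ℚ - x * z) ⊔ 0ℚ) ≤ z * ((r - γ) * (r - γ))
budget-bound {x} {r} {γ} {z} {n} {N} {EL} {VL} {EX} {VX} 0<N 0<n 0≤EL 0≤VL 0<z N≤EL+EX EX≤xzN VL+VX≤rn γn≤VX =
  ratio-bound {e = EL} {v = VL} {s = r - γ} {z = z}
    0<N 0<n (p≤q⊔p (1ℚ - x * z) 0ℚ) 0≤VL (<⇒≤ 0<z) aN≤EL VL≤[r-γ]n
  where
  aN≤EL : ((1ℚ - x * z) ⊔ 0ℚ) * N ≤ EL
  aN≤EL = begin
    ((1ℚ - x * z) ⊔ 0ℚ) * N    ≡⟨ mono-≤-distrib-⊔ (*-monoʳ-≤-0≤ (<⇒≤ 0<N)) (1ℚ - x * z) 0ℚ ⟩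
    (1ℚ - x * z) * N ⊔ 0ℚ * N  ≤⟨ ⊔-lub (≤-trans (≤-reflexive (expand x z N)) (p≤q+r⇒p-r≤q (begin
                                         N                ≤⟨ N≤EL+EX ⟩
                                         EL + EX          ≤⟨ +-monoʳ-≤ EL EX≤xzN ⟩
                                         EL + x * (z * N) ∎)))
                                       (≤-trans (≤-reflexive (*-zeroˡ N)) 0≤EL) ⟩
    EL                         ∎
    where
    open ≤-Reasoning
    expand : ∀ x z N → (1ℚ - x * z) * N ≡ N - x * (z * N)
    expand = solve-∀ ℚ-ring
  VL≤[r-γ]n : VL ≤ (r - γ) * n
  VL≤[r-γ]n = ≤-trans (p+q≤r⇒p≤r-q (≤-trans (+-monoʳ-≤ VL γn≤VX) VL+VX≤rn)) (≤-reflexive (factor r γ n))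
    where
    factor : ∀ r γ n → r * n - γ * n ≡ (r - γ) * n
    factor = solve-∀ ℚ-ring

edge-square-bound : ∀ {n r} (c : Coloring n r) (L : List (MonoComp c)) {z} → 0ℚ ≤ z →
                    (∀ K → ℕ→ℚ (esize K) ≤ z * ℕ→ℚ (n C 2)) →
                    (ℕ→ℚ (sum (map esize L)) * ℕ→ℚ n) * (ℕ→ℚ (sum (map esize L)) * ℕ→ℚ n)
                    ≤ (z * (ℕ→ℚ (n C 2) * ℕ→ℚ (n C 2))) * (ℕ→ℚ (sum (map vsize L)) * ℕ→ℚ (sum (map vsize L)))
edge-square-bound {n} c L {z} 0≤z E≤zN =
  subst (λ t → t * t ≤ (z * (N * N)) * (ℕ→ℚ (sum (map vsize L)) * ℕ→ℚ (sum (map vsize L))))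
        (trans (cong ℕ→ℚ (sum-map-*ʳ esize n L)) (ℕ→ℚ-homo-* (sum (map esize L)) n))
        (sum-square-bound (λ K → esize K ℕ.* n) vsize L (*-nonNeg 0≤z (square-nonNeg N)) component-bound)
  where
  N = ℕ→ℚ (n C 2)
  component-bound : ∀ K → ℕ→ℚ (esize K ℕ.* n) * ℕ→ℚ (esize K ℕ.* n)
                          ≤ (z * (N * N)) * (ℕ→ℚ (vsize K) * ℕ→ℚ (vsize K))
  component-bound K = subst (λ t → t * t ≤ (z * (N * N)) * (ℕ→ℚ (vsize K) * ℕ→ℚ (vsize K)))
    (sym (ℕ→ℚ-homo-* (esize K) n))
    (density-square-bound {v = ℕ→ℚ (vsize K)} {n = ℕ→ℚ n} {N = N} {z = z}
      (ℕ→ℚ-nonNeg (esize K)) (ℕ→ℚ-nonNeg (n C 2))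
      (subst₂ _≤_ (trans (ℕ→ℚ-homo-* (esize K) (n ℕ.* n)) (cong (ℕ→ℚ (esize K) *_) (ℕ→ℚ-homo-* n n)))
                  (trans (ℕ→ℚ-homo-* (vsize K ℕ.* vsize K) (n C 2))
                         (cong (_* N) (ℕ→ℚ-homo-* (vsize K) (vsize K))))
                  (ℕ→ℚ-mono-≤ {esize K ℕ.* (n ℕ.* n)} {(vsize K ℕ.* vsize K) ℕ.* (n C 2)} (esize-bound c K)))
      (E≤zN K))

proposition2p1 : (r n : ℕ) → r ≥ 2 → n ≥ 2 → (c : Coloring n r)
    → (X : List (MonoComp c)) → AllPairs DistinctComp X
    → (γ z : ℚ) → 0ℚ ≤ γ → γ ≤ ℕ→ℚ r → 0ℚ < z
    → γ * ℕ→ℚ n ≤ ℕ→ℚ (sum (map vsize X))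
    → (∀ (K : MonoComp c) → ℕ→ℚ (esize K) ≤ z * ℕ→ℚ (n C 2))
    → ((1ℚ - ℕ→ℚ (length X) * z) ⊔ 0ℚ) * ((1ℚ - ℕ→ℚ (length X) * z) ⊔ 0ℚ)
    ≤ z * ((ℕ→ℚ r - γ) * (ℕ→ℚ r - γ))
proposition2p1 r n _ n≥2 c X X-distinct γ z _ _ 0<z γn≤VX E≤zN
  with remaining-components c X X-distinct
... | L , N≤EL+EX , VL+VX≤rn =
  -- Unification unfolds the casts ℕ→ℚ and gets stuck, so the implicit arguments are explicit.
  budget-bound {x = ℕ→ℚ (length X)} {r = ℕ→ℚ r} {γ = γ} {z = z} {n = ℕ→ℚ n} {N = ℕ→ℚ (n C 2)}
    (ℕ→ℚ-mono-< (0<nC2 n≥2)) (ℕ→ℚ-mono-< {0} {n} (ℕ.≤-trans (ℕ.s≤s ℕ.z≤n) n≥2))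
    (ℕ→ℚ-nonNeg (sum (map esize L))) (ℕ→ℚ-nonNeg (sum (map vsize L))) 0<z
    (ℕ→ℚ-mono-≤-+ {n C 2} {sum (map esize L)} {sum (map esize X)} N≤EL+EX) (sum≤length*bound esize X E≤zN)
    (ℕ→ℚ-mono-≤-+-* {sum (map vsize L)} {sum (map vsize X)} {r} {n} VL+VX≤rn) γn≤VX
    (edge-square-bound c L (<⇒≤ 0<z) E≤zN)
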